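{- Consider the buffer management problem with exactly two packet values $1$ and $\alpha>1$, with exactly one queue for each value and both queues of the same capacity $B$. Then the online algorithm GREEDY is $\frac{\alpha+2}{\alpha+1}$-competitive, i.e., for every input sequence $\sigma$, $\mathrm{OPT}(\sigma)\le \frac{\alpha+2}{\alpha+1}\,\mathrm{GREEDY}(\sigma)$.
   Context: Model: packets of value $1$ or $\alpha$ arrive over time (at non-integral times), chosen by an adversary; each goes to the queue of its value, which holds at most $B$ packets, and is either admitted (only if there is room) or rejected. At the end of each unit time step (send event) at most one packet from a non-empty queue is transmitted. Benefit is the total value of transmitted packets. $\mathrm{OPT}(\sigma)$ is the maximum benefit achievable by an offline algorithm knowing $\sigma$ in advance. GREEDY accepts every packet whose queue is not full, and at each send event sends an $\alpha$-packet if its $\alpha$-queue is non-empty, otherwise a $1$-packet if available.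
   Formalization: The packet value α ranges only over the rationals greater than 1. -}

module Defs where

open import Data.Nat using (ℕ; zero; suc; _<?_)
open import Data.Bool using (Bool; true; false)
open import Data.List using (List; []; _∷_)
open import Data.Maybe using (Maybe; just; nothing)
open import Data.Product using (_×_; _,_)
open import Data.Integer using (+_)
open import Data.Rational using (ℚ; _/_; _+_; _*_)
open import Relation.Nullary using (yes; no)
open import Relation.Binary.PropositionalEquality using (_≡_)

data Val : Set where
  one   : Val
  alpha : Val

-- One unit time step: the packets arriving (in order, at non-integral
-- times) during the step, followed by the send event at its end.
Step : Set
Step = List Val

Input : Set
Input = List Step

-- Buffer state: (number of packets in the 1-queue , number in the α-queue).
State : Set
State = ℕ × ℕ

-- Transmitted packets: (number of 1-packets , number of α-packets).
Sent : Set
Sent = ℕ × ℕ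

-- Decisions for one step: admit/reject for each arriving packet (in order),
-- and the send-event choice: nothing = transmit nothing, just v = transmit
-- a packet from the v-queue.
StepDecision : Set
StepDecision = List Bool × Maybe Val

Schedule : Set
Schedule = List StepDecision

-- Process arrivals under admission decisions; nothing = infeasible
-- (a packet is admitted into a full queue, or decision list mismatches).
admit : ℕ → List Val → List Bool → State → Maybe State
admit B [] [] q = just q
admit B [] (_ ∷ _) q = nothing
admit B (_ ∷ _) [] q = nothing
admit B (_ ∷ vs) (false ∷ bs) q = admit B vs bs q
admit B (one ∷ vs) (true ∷ bs) (a , b) with a <? B
... | yes _ = admit B vs bs (suc a , b)
... | no _ = nothing
admit B (alpha ∷ vs) (true ∷ bs) (a , b) with b <? B
... | yes _ = admit B vs bs (a , suc b)
... | no _ = nothing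

-- Send event; nothing = infeasible (sending from an empty queue).
send : Maybe Val → State → Sent → Maybe (State × Sent)
send nothing q s = just (q , s)
send (just one) (zero , b) s = nothing
send (just one) (suc a , b) (x , y) = just ((a , b) , (suc x , y))
send (just alpha) (a , zero) s = nothing
send (just alpha) (a , suc b) (x , y) = just ((a , b) , (x , suc y))

run : ℕ → Input → Schedule → State → Sent → Maybe Sent
run B [] [] q s = just s
run B [] (_ ∷ _) q s = nothing
run B (_ ∷ _) [] q s = nothing
run B (st ∷ σ) ((bs , c) ∷ ds) q s with admit B st bs q
... | nothing = nothing
... | just q′ with send c q′ s
...   | nothing = nothing
...   | just (q″ , s′) = run B σ ds q″ s′

Transmits : ℕ → Input → Schedule → Sent → Set
Transmits B σ S r = run B σ S (0 , 0) (0 , 0) ≡ just r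

greedyAdmit : ℕ → List Val → State → State
greedyAdmit B [] q = q
greedyAdmit B (one ∷ vs) (a , b) with a <? B
... | yes _ = greedyAdmit B vs (suc a , b)
... | no _ = greedyAdmit B vs (a , b)
greedyAdmit B (alpha ∷ vs) (a , b) with b <? B
... | yes _ = greedyAdmit B vs (a , suc b)
... | no _ = greedyAdmit B vs (a , b)

greedySend : State → Sent → State × Sent
greedySend (a , suc b) (x , y) = (a , b) , (x , suc y)
greedySend (suc a , zero) (x , y) = (a , zero) , (suc x , y)
greedySend (zero , zero) s = (zero , zero) , s

greedyRun : ℕ → Input → State → Sent → Sent
greedyRun B [] q s = s
greedyRun B (st ∷ σ) q s with greedySend (greedyAdmit B st q) s
... | (q′ , s′) = greedyRun B σ q′ s′

GREEDY-sent : ℕ → Input → Sent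
GREEDY-sent B σ = greedyRun B σ (0 , 0) (0 , 0)

ℕ→ℚ : ℕ → ℚ
ℕ→ℚ n = + n / 1

benefit : ℚ → Sent → ℚ
benefit α (x , y) = ℕ→ℚ x + α * ℕ→ℚ y

GREEDY : ℚ → ℕ → Input → ℚ
GREEDY α B σ = benefit α (GREEDY-sent B σ)

module Submission where

-- Let GREEDY send x 1-packets and y α-packets, and a feasible schedule u and v.
-- Then v ≤ y, u ≤ x + y and u + v ≤ 2x + y. None of these is inductive by
-- itself: each is carried along with its analogue in which queued packets are
-- counted as sent, so that a packet the schedule admits while GREEDY's queue of
-- the same value is full is paid for by the B packets in that queue. Adding the
-- three inequalities with weights α² + α − 1, α and 1 gives
-- (α + 1)(u + αv) ≤ (α + 2)(x + αy).

open import Defs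
open import Data.Nat using (ℕ)

module Domination where
  open import Data.Nat using (zero; suc; _+_; _≤_; _<?_; z≤n)
  open import Data.Nat.Properties
    using (≤-trans; ≤-refl; <⇒≤; n≤1+n; ≮⇒≥; m≤m+n; +-mono-≤; +-monoʳ-≤; +-cancelʳ-≤; module ≤-Reasoning)
  open import Data.Nat.Tactic.RingSolver using (solve)
  open import Data.List using (List; []; _∷_)
  open import Data.Bool using (true; false)
  open import Data.Maybe using (just; nothing)
  open import Data.Product using (_×_; _,_)
  open import Relation.Nullary using (yes; no)
  open import Relation.Binary.PropositionalEquality using (_≡_; refl)

  _≼_ : Sent → Sent → Set
  (u , v) ≼ (x , y) = v ≤ y × u ≤ x + y × u + v ≤ x + x + y

  -- GREEDY holds a 1-packets and b α-packets and has sent x and y of them;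
  -- the offline schedule holds p and q and has sent u and v.
  record Dominated (B a b x y p q u v : ℕ) : Set where
    field
      queuedα≤B     : q ≤ B
      sentα         : v ≤ y
      sentα+queuedα : v + q ≤ y + b
      sent₁         : u ≤ x + y
      sent₁+queued₁ : u + p ≤ x + y + a
      sent          : u + v ≤ x + x + y
      sent+queued₁  : u + v + p ≤ x + x + y + (a + a)
      sent+queued   : u + v + p + q ≤ x + x + y + (a + a) + b

  open Dominated

  dominated-initially : ∀ {B} → Dominated B 0 0 0 0 0 0 0 0
  dominated-initially = record
    { queuedα≤B = z≤n ; sentα = z≤n ; sentα+queuedα = z≤n ; sent₁ = z≤n
    ; sent₁+queued₁ = z≤n ; sent = z≤n ; sent+queued₁ = z≤n ; sent+queued = z≤n }

  ≤-shift : ∀ {m n m′ n′} e → m ≤ n → m′ + n + e ≡ n′ + m → m′ ≤ n′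
  ≤-shift {m} {n} {m′} {n′} e m≤n eq = +-cancelʳ-≤ n m′ n′ (begin
    m′ + n      ≤⟨ m≤m+n (m′ + n) e ⟩
    m′ + n + e  ≡⟨ eq ⟩
    n′ + m      ≤⟨ +-monoʳ-≤ n′ m≤n ⟩
    n′ + n      ∎)
    where open ≤-Reasoning

  greedy-queues-mono : ∀ {B a b a′ b′ x y p q u v} → a ≤ a′ → b ≤ b′ →
    Dominated B a b x y p q u v → Dominated B a′ b′ x y p q u v
  greedy-queues-mono {a = a} {a′ = a′} {x = x} {y} a≤a′ b≤b′ I = record
    { Dominated I hiding (sentα+queuedα; sent₁+queued₁; sent+queued₁; sent+queued)
    ; sentα+queuedα = ≤-trans (sentα+queuedα I) (+-monoʳ-≤ y b≤b′)
    ; sent₁+queued₁ = ≤-trans (sent₁+queued₁ I) (+-monoʳ-≤ (x + y) a≤a′)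
    ; sent+queued₁  = ≤-trans (sent+queued₁ I) (+-monoʳ-≤ (x + x + y) 2a≤2a′)
    ; sent+queued   = ≤-trans (sent+queued I) (+-mono-≤ (+-monoʳ-≤ (x + x + y) 2a≤2a′) b≤b′)
    }
    where
    2a≤2a′ : a + a ≤ a′ + a′
    2a≤2a′ = +-mono-≤ a≤a′ a≤a′

  module _ {B a b x y p q u v : ℕ} where
    private
      vars : List ℕ
      vars = a ∷ b ∷ x ∷ y ∷ p ∷ q ∷ u ∷ v ∷ []

    both-admit₁ : Dominated B a b x y p q u v → Dominated B (suc a) b x y (suc p) q u v
    both-admit₁ I = record
      { Dominated I hiding (sent₁+queued₁; sent+queued₁; sent+queued)
      ; sent₁+queued₁ = ≤-shift 0 (sent₁+queued₁ I) (solve vars)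
      ; sent+queued₁  = ≤-shift 1 (sent+queued₁ I) (solve vars)
      ; sent+queued   = ≤-shift 1 (sent+queued I) (solve vars)
      }

    both-admitα : suc q ≤ B → Dominated B a b x y p q u v → Dominated B a (suc b) x y p (suc q) u v
    both-admitα q<B I = record
      { Dominated I hiding (queuedα≤B; sentα+queuedα; sent+queued)
      ; queuedα≤B     = q<B
      ; sentα+queuedα = ≤-shift 0 (sentα+queuedα I) (solve vars)
      ; sent+queued   = ≤-shift 0 (sent+queued I) (solve vars)
      }

    only-opt-admits₁ : B ≤ a → suc p ≤ B → Dominated B a b x y p q u v → Dominated B a b x y (suc p) q u v
    only-opt-admits₁ B≤a p<B I = record
      { Dominated I hiding (sent₁+queued₁; sent+queued₁; sent+queued)
      ; sent₁+queued₁ = +-mono-≤ (sent₁ I) p<a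
      ; sent+queued₁  = ≤-shift a (+-mono-≤ (sent I) p<a) (solve vars)
      ; sent+queued   = ≤-shift b (+-mono-≤ (+-mono-≤ (sent I) p<a) (≤-trans (queuedα≤B I) B≤a)) (solve vars)
      }
      where
      p<a : suc p ≤ a
      p<a = ≤-trans p<B B≤a

    only-opt-admitsα : B ≤ b → suc q ≤ B → Dominated B a b x y p q u v → Dominated B a b x y p (suc q) u v
    only-opt-admitsα B≤b q<B I = record
      { Dominated I hiding (queuedα≤B; sentα+queuedα; sent+queued)
      ; queuedα≤B     = q<B
      ; sentα+queuedα = +-mono-≤ (sentα I) q<b
      ; sent+queued   = +-mono-≤ (sent+queued₁ I) q<b
      }
      where
      q<b : suc q ≤ b
      q<b = ≤-trans q<B B≤b

  module _ {B x y p q u v : ℕ} where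
    private
      vars : List ℕ
      vars = x ∷ y ∷ p ∷ q ∷ u ∷ v ∷ []

    greedySend-vs-idle : ∀ {a b a′ b′ x′ y′} → greedySend (a , b) (x , y) ≡ ((a′ , b′) , (x′ , y′)) →
      Dominated B a b x y p q u v → Dominated B a′ b′ x′ y′ p q u v
    greedySend-vs-idle {a} {suc b} refl I = record
      { Dominated I using (queuedα≤B)
      ; sentα         = ≤-shift 1 (sentα I) (solve (a ∷ b ∷ vars))
      ; sentα+queuedα = ≤-shift 0 (sentα+queuedα I) (solve (a ∷ b ∷ vars))
      ; sent₁         = ≤-shift 1 (sent₁ I) (solve (a ∷ b ∷ vars))
      ; sent₁+queued₁ = ≤-shift 1 (sent₁+queued₁ I) (solve (a ∷ b ∷ vars))
      ; sent          = ≤-shift 1 (sent I) (solve (a ∷ b ∷ vars))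
      ; sent+queued₁  = ≤-shift 1 (sent+queued₁ I) (solve (a ∷ b ∷ vars))
      ; sent+queued   = ≤-shift 0 (sent+queued I) (solve (a ∷ b ∷ vars))
      }
    greedySend-vs-idle {suc a} {zero} refl I = record
      { Dominated I hiding (sent₁; sent₁+queued₁; sent; sent+queued₁; sent+queued)
      ; sent₁         = ≤-shift 1 (sent₁ I) (solve (a ∷ vars))
      ; sent₁+queued₁ = ≤-shift 0 (sent₁+queued₁ I) (solve (a ∷ vars))
      ; sent          = ≤-shift 2 (sent I) (solve (a ∷ vars))
      ; sent+queued₁  = ≤-shift 0 (sent+queued₁ I) (solve (a ∷ vars))
      ; sent+queued   = ≤-shift 0 (sent+queued I) (solve (a ∷ vars))
      }
    greedySend-vs-idle {zero} {zero} refl I = I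

    greedySend-vs-send₁ : ∀ {a b a′ b′ x′ y′} → greedySend (a , b) (x , y) ≡ ((a′ , b′) , (x′ , y′)) →
      Dominated B a b x y (suc p) q u v → Dominated B a′ b′ x′ y′ p q (suc u) v
    greedySend-vs-send₁ {a} {suc b} refl I = record
      { Dominated I using (queuedα≤B)
      ; sentα         = ≤-shift 1 (sentα I) (solve (a ∷ b ∷ vars))
      ; sentα+queuedα = ≤-shift 0 (sentα+queuedα I) (solve (a ∷ b ∷ vars))
      ; sent₁         = ≤-shift 0 (sent₁ I) (solve (a ∷ b ∷ vars))
      ; sent₁+queued₁ = ≤-shift 1 (sent₁+queued₁ I) (solve (a ∷ b ∷ vars))
      ; sent          = ≤-shift 0 (sent I) (solve (a ∷ b ∷ vars))
      ; sent+queued₁  = ≤-shift 1 (sent+queued₁ I) (solve (a ∷ b ∷ vars))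
      ; sent+queued   = ≤-shift 0 (sent+queued I) (solve (a ∷ b ∷ vars))
      }
    greedySend-vs-send₁ {suc a} {zero} refl I = record
      { Dominated I hiding (sent₁; sent₁+queued₁; sent; sent+queued₁; sent+queued)
      ; sent₁         = ≤-shift 0 (sent₁ I) (solve (a ∷ vars))
      ; sent₁+queued₁ = ≤-shift 0 (sent₁+queued₁ I) (solve (a ∷ vars))
      ; sent          = ≤-shift 1 (sent I) (solve (a ∷ vars))
      ; sent+queued₁  = ≤-shift 0 (sent+queued₁ I) (solve (a ∷ vars))
      ; sent+queued   = ≤-shift 0 (sent+queued I) (solve (a ∷ vars))
      }
    greedySend-vs-send₁ {zero} {zero} refl I = record
      { Dominated I hiding (sent₁; sent₁+queued₁; sent; sent+queued₁; sent+queued)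
      ; sent₁         = ≤-shift p (sent₁+queued₁ I) (solve vars)
      ; sent₁+queued₁ = ≤-shift 0 (sent₁+queued₁ I) (solve vars)
      ; sent          = ≤-shift p (sent+queued₁ I) (solve vars)
      ; sent+queued₁  = ≤-shift 0 (sent+queued₁ I) (solve vars)
      ; sent+queued   = ≤-shift 0 (sent+queued I) (solve vars)
      }

    greedySend-vs-sendα : ∀ {a b a′ b′ x′ y′} → greedySend (a , b) (x , y) ≡ ((a′ , b′) , (x′ , y′)) →
      Dominated B a b x y p (suc q) u v → Dominated B a′ b′ x′ y′ p q u (suc v)
    greedySend-vs-sendα {a} {suc b} refl I = record
      { queuedα≤B     = <⇒≤ (queuedα≤B I)
      ; sentα         = ≤-shift 0 (sentα I) (solve (a ∷ b ∷ vars))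
      ; sentα+queuedα = ≤-shift 0 (sentα+queuedα I) (solve (a ∷ b ∷ vars))
      ; sent₁         = ≤-shift 1 (sent₁ I) (solve (a ∷ b ∷ vars))
      ; sent₁+queued₁ = ≤-shift 1 (sent₁+queued₁ I) (solve (a ∷ b ∷ vars))
      ; sent          = ≤-shift 0 (sent I) (solve (a ∷ b ∷ vars))
      ; sent+queued₁  = ≤-shift 0 (sent+queued₁ I) (solve (a ∷ b ∷ vars))
      ; sent+queued   = ≤-shift 0 (sent+queued I) (solve (a ∷ b ∷ vars))
      }
    greedySend-vs-sendα {suc a} {zero} refl I = record
      { queuedα≤B     = <⇒≤ (queuedα≤B I)
      ; sentα         = ≤-shift q (sentα+queuedα I) (solve (a ∷ vars))
      ; sentα+queuedα = ≤-shift 0 (sentα+queuedα I) (solve (a ∷ vars))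
      ; sent₁         = ≤-shift 1 (sent₁ I) (solve (a ∷ vars))
      ; sent₁+queued₁ = ≤-shift 0 (sent₁+queued₁ I) (solve (a ∷ vars))
      ; sent          = ≤-shift 1 (sent I) (solve (a ∷ vars))
      ; sent+queued₁  = ≤-shift q (sent+queued I) (solve (a ∷ vars))
      ; sent+queued   = ≤-shift 0 (sent+queued I) (solve (a ∷ vars))
      }
    greedySend-vs-sendα {zero} {zero} refl I = record
      { Dominated I using (sent₁; sent₁+queued₁)
      ; queuedα≤B     = <⇒≤ (queuedα≤B I)
      ; sentα         = ≤-shift q (sentα+queuedα I) (solve vars)
      ; sentα+queuedα = ≤-shift 0 (sentα+queuedα I) (solve vars)
      ; sent          = ≤-shift (p + q) (sent+queued I) (solve vars)
      ; sent+queued₁  = ≤-shift q (sent+queued I) (solve vars)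
      ; sent+queued   = ≤-shift 0 (sent+queued I) (solve vars)
      }

  admit-step : ∀ {B} st bs {a b x y p q u v p′ q′} → admit B st bs (p , q) ≡ just (p′ , q′) →
    Dominated B a b x y p q u v →
    let (a′ , b′) = greedyAdmit B st (a , b) in Dominated B a′ b′ x y p′ q′ u v
  admit-step [] [] refl I = I
  admit-step [] (_ ∷ _) () I
  admit-step (_ ∷ _) [] () I
  admit-step {B} (one ∷ vs) (false ∷ bs) {a} e I with a <? B
  ... | yes _ = admit-step vs bs e (greedy-queues-mono (n≤1+n a) ≤-refl I)
  ... | no _  = admit-step vs bs e I
  admit-step {B} (alpha ∷ vs) (false ∷ bs) {b = b} e I with b <? B
  ... | yes _ = admit-step vs bs e (greedy-queues-mono ≤-refl (n≤1+n b) I)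
  ... | no _  = admit-step vs bs e I
  admit-step {B} (one ∷ vs) (true ∷ bs) {a} {p = p} e I with p <? B | a <? B
  ... | yes p<B | yes _   = admit-step vs bs e (both-admit₁ I)
  ... | yes p<B | no a≮B  = admit-step vs bs e (only-opt-admits₁ (≮⇒≥ a≮B) p<B I)
  ... | no _    | _ with () ← e
  admit-step {B} (alpha ∷ vs) (true ∷ bs) {b = b} {q = q} e I with q <? B | b <? B
  ... | yes q<B | yes _   = admit-step vs bs e (both-admitα q<B I)
  ... | yes q<B | no b≮B  = admit-step vs bs e (only-opt-admitsα (≮⇒≥ b≮B) q<B I)
  ... | no _    | _ with () ← e

  send-step : ∀ {B} c {a b x y p q u v p′ q′ u′ v′} →
    send c (p , q) (u , v) ≡ just ((p′ , q′) , (u′ , v′)) → Dominated B a b x y p q u v →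
    let ((a′ , b′) , (x′ , y′)) = greedySend (a , b) (x , y) in Dominated B a′ b′ x′ y′ p′ q′ u′ v′
  send-step nothing                 refl = greedySend-vs-idle refl
  send-step (just one)   {p = zero}  ()
  send-step (just one)   {p = suc _} refl = greedySend-vs-send₁ refl
  send-step (just alpha) {q = zero}  ()
  send-step (just alpha) {q = suc _} refl = greedySend-vs-sendα refl

  greedy-dominates : ∀ {B} σ S {a b x y p q u v} r → run B σ S (p , q) (u , v) ≡ just r →
    Dominated B a b x y p q u v → r ≼ greedyRun B σ (a , b) (x , y)
  greedy-dominates [] [] _ refl I = sentα I , sent₁ I , sent I
  greedy-dominates [] (_ ∷ _) _ () I
  greedy-dominates (_ ∷ _) [] _ () I
  greedy-dominates {B} (st ∷ σ) ((bs , c) ∷ S) {p = p} {q} {u} {v} r e I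
    with admit B st bs (p , q) in admitted
  ... | nothing with () ← e
  ... | just (p′ , q′) with send c (p′ , q′) (u , v) in sent′
  ...   | nothing with () ← e
  ...   | just _ = greedy-dominates σ S r e (send-step c sent′ (admit-step st bs admitted I))

import Data.Nat as ℕ
import Data.Nat.Properties as ℕ
import Data.Integer as ℤ
import Data.Integer.Properties as ℤ
open import Data.Integer using (+_)
open import Data.Nat.Coprimality using (1-coprimeTo) renaming (sym to coprime-sym)
open import Data.Product using (_,_)
open import Data.Rational using (ℚ; 0ℚ; 1ℚ; mkℚ; _/_; -_; _+_; _-_; _*_; _≤_; _<_; NonNegative; nonNegative)
open import Data.Rational.Properties
  using (≤-trans; <⇒≤; +-mono-≤; +-monoʳ-≤; +-monoˡ-≤; +-identityʳ; *-monoˡ-≤-nonNeg;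
         nonNegative⁻¹; nonNeg*nonNeg⇒nonNeg; normalize-coprime; normalize-nonNeg; module ≤-Reasoning)
open import Data.Rational.Solver using (module +-*-Solver)
open import Relation.Binary.PropositionalEquality using (_≡_; refl; trans; cong; cong₂; module ≡-Reasoning)
open Domination using (_≼_; greedy-dominates; dominated-initially)

ℕ→ℚ-+ : ∀ m n → ℕ→ℚ (m ℕ.+ n) ≡ ℕ→ℚ m + ℕ→ℚ n
ℕ→ℚ-+ m n = begin
  + (m ℕ.+ n) / 1                     ≡⟨ cong (_/ 1) (cong₂ ℤ._+_ (ℤ.*-identityʳ (+ m)) (ℤ.*-identityʳ (+ n))) ⟨
  (+ m ℤ.* + 1 ℤ.+ + n ℤ.* + 1) / 1  ≡⟨ cong₂ _+_ (ℕ→ℚ-mkℚ m) (ℕ→ℚ-mkℚ n) ⟨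
  ℕ→ℚ m + ℕ→ℚ n                       ∎
  where
  open ≡-Reasoning
  ℕ→ℚ-mkℚ : ∀ k → ℕ→ℚ k ≡ mkℚ (+ k) 0 (coprime-sym (1-coprimeTo k))
  ℕ→ℚ-mkℚ k = normalize-coprime (coprime-sym (1-coprimeTo k))

ℕ→ℚ-nonNeg : ∀ n → 0ℚ ≤ ℕ→ℚ n
ℕ→ℚ-nonNeg n = nonNegative⁻¹ (ℕ→ℚ n) {{normalize-nonNeg n 1}}

ℕ→ℚ-mono-≤ : ∀ {m n} → m ℕ.≤ n → ℕ→ℚ m ≤ ℕ→ℚ n
ℕ→ℚ-mono-≤ {m} {n} m≤n = begin
  ℕ→ℚ m                        ≡⟨ +-identityʳ (ℕ→ℚ m) ⟨
  ℕ→ℚ m + 0ℚ                   ≤⟨ +-monoʳ-≤ (ℕ→ℚ m) (ℕ→ℚ-nonNeg (n ℕ.∸ m)) ⟩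
  ℕ→ℚ m + ℕ→ℚ (n ℕ.∸ m)       ≡⟨ ℕ→ℚ-+ m (n ℕ.∸ m) ⟨
  ℕ→ℚ (m ℕ.+ (n ℕ.∸ m))       ≡⟨ cong ℕ→ℚ (ℕ.m+[n∸m]≡n m≤n) ⟩
  ℕ→ℚ n                        ∎
  where open ≤-Reasoning

≼⇒benefit≤ : ∀ {α} → 1ℚ ≤ α → ∀ {r g} → r ≼ g →
  (α + 1ℚ) * benefit α r ≤ (α + 1ℚ + 1ℚ) * benefit α g
≼⇒benefit≤ {α} 1≤α {u , v} {x , y} (v≤y , u≤x+y , u+v≤x+x+y) = begin
  (α + 1ℚ) * (U + α * V)                          ≡⟨ split U V ⟩
  α * U + (U + V) + c * V                         ≡⟨ cong (λ t → α * U + t + c * V) (ℕ→ℚ-+ u v) ⟨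
  α * U + ℕ→ℚ (u ℕ.+ v) + c * V                   ≤⟨ +-mono-≤ (+-mono-≤ (*-monoˡ-≤-nonNeg α (ℕ→ℚ-mono-≤ u≤x+y))
                                                                    (ℕ→ℚ-mono-≤ u+v≤x+x+y))
                                                          (*-monoˡ-≤-nonNeg c (ℕ→ℚ-mono-≤ v≤y)) ⟩
  α * ℕ→ℚ (x ℕ.+ y) + ℕ→ℚ (x ℕ.+ x ℕ.+ y) + c * Y ≡⟨ cong₂ (λ s t → α * s + t + c * Y) (ℕ→ℚ-+ x y) X+X+Y ⟩
  α * (X + Y) + (X + X + Y) + c * Y               ≡⟨ split′ X Y ⟩
  (α + 1ℚ + 1ℚ) * (X + α * Y)                     ∎
  where
  open ≤-Reasoning
  open +-*-Solver
  U V X Y c : ℚ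
  U = ℕ→ℚ u
  V = ℕ→ℚ v
  X = ℕ→ℚ x
  Y = ℕ→ℚ y
  c = α * α + (α - 1ℚ)
  instance
    α-nonNeg : NonNegative α
    α-nonNeg = nonNegative (≤-trans (nonNegative⁻¹ 1ℚ) 1≤α)
    c-nonNeg : NonNegative c
    c-nonNeg = nonNegative (+-mono-≤ (nonNegative⁻¹ (α * α) {{nonNeg*nonNeg⇒nonNeg α α}})
                                     (+-monoˡ-≤ (- 1ℚ) 1≤α))
  X+X+Y : ℕ→ℚ (x ℕ.+ x ℕ.+ y) ≡ X + X + Y
  X+X+Y = trans (ℕ→ℚ-+ (x ℕ.+ x) y) (cong (_+ Y) (ℕ→ℚ-+ x x))
  split : ∀ U V → (α + 1ℚ) * (U + α * V) ≡ α * U + (U + V) + c * V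
  split = solve 3 (λ α U V → (α :+ con 1ℚ) :* (U :+ α :* V)
                           := α :* U :+ (U :+ V) :+ (α :* α :+ (α :- con 1ℚ)) :* V) refl α
  split′ : ∀ X Y → α * (X + Y) + (X + X + Y) + c * Y ≡ (α + 1ℚ + 1ℚ) * (X + α * Y)
  split′ = solve 3 (λ α X Y → α :* (X :+ Y) :+ (X :+ X :+ Y) :+ (α :* α :+ (α :- con 1ℚ)) :* Y
                            := (α :+ con 1ℚ :+ con 1ℚ) :* (X :+ α :* Y)) refl α

theorem3 : (α : ℚ) → 1ℚ < α → (B : ℕ) → (σ : Input) →
    (S : Schedule) → (r : Sent) → Transmits B σ S r →
    (α + 1ℚ) * benefit α r ≤ (α + 1ℚ + 1ℚ) * GREEDY α B σ
theorem3 α 1<α B σ S r r-sent = ≼⇒benefit≤ (<⇒≤ 1<α) (greedy-dominates σ S r r-sent dominated-initially)
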